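{- Let $a$ be a permutation of $[n]=\{1,\dots,n\}$. Then there exists a permutation $a'$ of $[n]$ and an index $k\in[n]$ such that $|L(a)|\le|L(a')|$, $a'_1,\dots,a'_k$ is increasing, and $a'_k,a'_{k+1},\dots,a'_n$ is decreasing.
   Context: For a permutation $a$ of $[n]$, $L(a):=\left\{(u,v)\in[n]^2 : u\le v,\ \sum_{i=u}^v a_i\ge\frac12\binom{n+1}{2}\right\}$. -}

module Defs where

open import Data.Nat using (ℕ; zero; suc; _+_; _*_; _≤_; _<_; _≤?_)
open import Data.Nat.Combinatorics using (_C_)
open import Data.Fin using (Fin; toℕ)
open import Data.Fin.Permutation using (Permutation′; _⟨$⟩ʳ_)
open import Data.List using (List; []; _∷_; length; filter; concatMap; allFin; map)
open import Data.Nat.ListAction using (sum)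
open import Data.Product using (_×_; _,_)
import Data.Fin as F

-- A permutation a of [n] = {1..n}: positions are Fin n (position i ↔ i+1),
-- and the value at position i is  toℕ (π i) + 1  ∈ [n].
val : {n : ℕ} → Permutation′ n → Fin n → ℕ
val π i = suc (toℕ (π ⟨$⟩ʳ i))

segSum : {n : ℕ} → Permutation′ n → Fin n → Fin n → ℕ
segSum {n} π u v =
  sum (map (val π) (filter (λ i → toℕ u ≤? toℕ i) (filter (λ i → toℕ i ≤? toℕ v) (allFin n))))

pairs : (n : ℕ) → List (Fin n × Fin n)
pairs n = filter (λ p → toℕ (Data.Product.proj₁ p) ≤? toℕ (Data.Product.proj₂ p))
                 (concatMap (λ u → map (λ v → (u , v)) (allFin n)) (allFin n))

-- L(a) as a list (without repetitions): pairs u ≤ v with  Σ_{i=u}^v a_i ≥ ½ binom(n+1,2),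
-- i.e.  binom(n+1,2) ≤ 2 · Σ_{i=u}^v a_i.
Lset : {n : ℕ} → Permutation′ n → List (Fin n × Fin n)
Lset {n} π = filter (λ p → (suc n C 2) ≤? 2 * segSum π (Data.Product.proj₁ p) (Data.Product.proj₂ p)) (pairs n)

cardL : {n : ℕ} → Permutation′ n → ℕ
cardL π = length (Lset π)

-- a_1,…,a_k increasing (k-th position is Fin index k0, 0-based)
IncreasingUpTo : {n : ℕ} → Permutation′ n → Fin n → Set
IncreasingUpTo π k = ∀ i j → toℕ i < toℕ j → toℕ j ≤ toℕ k → val π i < val π j

DecreasingFrom : {n : ℕ} → Permutation′ n → Fin n → Set
DecreasingFrom π k = ∀ i j → toℕ k ≤ toℕ i → toℕ i < toℕ j → val π j < val π i

module Submission where

open import Defs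
open import Data.Nat using (ℕ; zero; suc; _+_; _*_; _≤_; _<_; _>_; _≤?_; _<?_; z≤n; s≤s; z<s; ∣_-_∣)
open import Data.Nat.Properties
open import Data.Nat.Combinatorics using (_C_; nC1≡n; nCk+nC[k+1]≡[n+1]C[k+1])
open import Data.Nat.Tactic.RingSolver using (solve-∀)
open import Data.Nat.Induction using (<-wellFounded)
open import Data.Nat.ListAction using (sum)
open import Algebra.Properties.CommutativeMonoid.Sum +-0-commutativeMonoid
  using (sum-syntax; sum-cong-≗; sum-init-last; sum-permute; ∑-distrib-+)
open import Data.Fin using (Fin; zero; suc; toℕ; inject₁; fromℕ; fromℕ<; lower₁)
import Data.Fin.Properties as Fin
open import Data.Fin.Induction using (<-weakInduction)
open import Data.Fin.Permutation using (Permutation′; _⟨$⟩ʳ_; _⟨$⟩ˡ_; transpose; _∘ₚ_; inverseˡ)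
open import Data.List using (List; []; _∷_; length; filter; map; allFin; tabulate)
open import Data.List.Membership.Propositional using (_∈_)
open import Data.List.Membership.Propositional.Properties using (∈-filter⁻)
open import Data.List.Properties using (filter-all)
open import Data.List.Relation.Unary.All as All using (All)
open import Data.List.Relation.Binary.Sublist.Propositional.Properties using (filter⁺; filter-⊆; length-mono-≤)
open import Data.List.Extrema.Nat using (argmin; argmin-all; f[argmin]≤f[xs])
open import Data.Product using (Σ; Σ-syntax; ∃; _×_; _,_; proj₁; proj₂)
open import Data.Sum using (_⊎_; inj₁; inj₂)
open import Function using (_∘_; id)
open import Induction.WellFounded using (Acc; acc)
open import Relation.Binary.Definitions using (tri<; tri≈; tri>)
open import Relation.Binary.PropositionalEquality
open import Relation.Nullary using (Dec; yes; no; ¬_)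
open import Relation.Nullary.Decidable using (dec-true; dec-false)
open import Relation.Nullary.Negation using (contradiction)
open import Relation.Unary using (Decidable)

-- Write every segment sum as a weighted sum Σ w(k) a_k, w being the indicator of the segment.
-- Two long segments separated by a gap would together carry less than the total n(n+1)/2, so
-- long segments pairwise meet, and the cut right after the leftmost right end of a long
-- segment meets all of them. Now bubble-sort a: increasingly left of the cut, decreasingly
-- right of it. Each swap moves the larger value towards the cut, i.e. onto a position whose
-- weight is at least as large for every weight rising up to the cut and falling after it,
-- indicators of segments meeting the cut included; by the rearrangement inequality no such
-- weighted sum decreases, so L(a) survives every swap, while the potential Σ |k − m| a_k
-- strictly drops. The sorted permutation is unimodal, with its peak at one side of the cut.

indicator : {P : Set} → Dec P → ℕ
indicator (yes _) = 1
indicator (no _)  = 0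

indicator≤1 : {P : Set} (P? : Dec P) → indicator P? ≤ 1
indicator≤1 (yes _) = ≤-refl
indicator≤1 (no _)  = z≤n

indicator-no : {P : Set} (P? : Dec P) → ¬ P → indicator P? ≡ 0
indicator-no (yes p) ¬p = contradiction p ¬p
indicator-no (no _)  _  = refl

indicator-mono : {P Q : Set} (P? : Dec P) (Q? : Dec Q) → (P → Q) → indicator P? ≤ indicator Q?
indicator-mono (yes p) (yes _) _   = ≤-refl
indicator-mono (yes p) (no ¬q) p→q = contradiction (p→q p) ¬q
indicator-mono (no _)  _       _   = z≤n

sum-map-filter : ∀ {A : Set} {P : A → Set} (P? : Decidable P) (g : A → ℕ) (xs : List A) →
                 sum (map g (filter P? xs)) ≡ sum (map (λ x → indicator (P? x) * g x) xs)
sum-map-filter P? g []       = refl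
sum-map-filter P? g (x ∷ xs) with P? x
... | yes _ = cong₂ _+_ (sym (*-identityˡ (g x))) (sum-map-filter P? g xs)
... | no _  = sum-map-filter P? g xs

sum-map-tabulate : ∀ {N} {A : Set} (g : A → ℕ) (f : Fin N → A) →
                   sum (map g (tabulate f)) ≡ ∑[ k < N ] g (f k)
sum-map-tabulate {zero}  g f = refl
sum-map-tabulate {suc N} g f = cong (g (f zero) +_) (sum-map-tabulate g (f ∘ suc))

length-filter-mono : ∀ {A : Set} {P Q : A → Set} (P? : Decidable P) (Q? : Decidable Q) (xs : List A) →
                     All Q (filter P? xs) → length (filter P? xs) ≤ length (filter Q? xs)
length-filter-mono P? Q? xs all-Q = begin
  length (filter P? xs)              ≡⟨ cong length (filter-all Q? all-Q) ⟨
  length (filter Q? (filter P? xs))  ≤⟨ length-mono-≤ (filter⁺ Q? Q? (λ { refl q → q }) (filter-⊆ P? xs)) ⟩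
  length (filter Q? xs)              ∎
  where open ≤-Reasoning

sum-mono-≤ : ∀ {N} {f g : Fin N → ℕ} → (∀ k → f k ≤ g k) → ∑[ k < N ] f k ≤ ∑[ k < N ] g k
sum-mono-≤ {zero}  _   = z≤n
sum-mono-≤ {suc N} f≤g = +-mono-≤ (f≤g zero) (sum-mono-≤ (f≤g ∘ suc))

sum-mono-< : ∀ {N} {f g : Fin N → ℕ} → (∀ k → f k ≤ g k) → ∀ z → f z < g z →
             ∑[ k < N ] f k < ∑[ k < N ] g k
sum-mono-< f≤g zero    f<g = +-mono-<-≤ f<g (sum-mono-≤ (f≤g ∘ suc))
sum-mono-< f≤g (suc z) f<g = +-mono-≤-< (f≤g zero) (sum-mono-< (f≤g ∘ suc) z f<g)

sum-suc-toℕ : ∀ N → ∑[ k < N ] suc (toℕ k) ≡ suc N C 2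
sum-suc-toℕ zero    = refl
sum-suc-toℕ (suc N) = begin
  ∑[ k < suc N ] suc (toℕ k)                              ≡⟨ sum-init-last (λ k → suc (toℕ k)) ⟩
  ∑[ k < N ] suc (toℕ (inject₁ k)) + suc (toℕ (fromℕ N))  ≡⟨ cong₂ _+_ (trans (sum-cong-≗ {N} (cong suc ∘ Fin.toℕ-inject₁)) (sum-suc-toℕ N))
                                                                       (cong suc (Fin.toℕ-fromℕ N)) ⟩
  suc N C 2 + suc N                                       ≡⟨ +-comm (suc N C 2) (suc N) ⟩
  suc N + suc N C 2                                       ≡⟨ cong (_+ suc N C 2) (nC1≡n (suc N)) ⟨
  suc N C 1 + suc N C 2                                   ≡⟨ nCk+nC[k+1]≡[n+1]C[k+1] (suc N) 1 ⟩
  suc (suc N) C 2                                         ∎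
  where open ≡-Reasoning

sum-agreeExcept-adjacent : ∀ {n} (j : Fin n) (f g : Fin (suc n) → ℕ) →
                           (∀ k → k ≢ inject₁ j → k ≢ suc j → f k ≡ g k) →
                           ∑[ k < suc n ] f k + (g (inject₁ j) + g (suc j)) ≡ ∑[ k < suc n ] g k + (f (inject₁ j) + f (suc j))
sum-agreeExcept-adjacent {suc n} zero f g agree =
  trans (cong (λ r → f zero + (f (suc zero) + r) + (g zero + g (suc zero))) rest)
        (regroup (f zero) (f (suc zero)) _ (g zero) (g (suc zero)))
  where
  rest : ∑[ k < n ] f (suc (suc k)) ≡ ∑[ k < n ] g (suc (suc k))
  rest = sum-cong-≗ (λ k → agree (suc (suc k)) (λ ()) (λ ()))
  regroup : ∀ a b r c d → a + (b + r) + (c + d) ≡ c + (d + r) + (a + b)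
  regroup = solve-∀
sum-agreeExcept-adjacent {suc n} (suc j) f g agree = begin
  f zero + F + (g p + g q)    ≡⟨ +-assoc (f zero) F _ ⟩
  f zero + (F + (g p + g q))  ≡⟨ cong₂ _+_ (agree zero (λ ()) (λ ())) (sum-agreeExcept-adjacent j (f ∘ suc) (g ∘ suc) agree′) ⟩
  g zero + (G + (f p + f q))  ≡⟨ +-assoc (g zero) G _ ⟨
  g zero + G + (f p + f q)    ∎
  where
  open ≡-Reasoning
  p = suc (inject₁ j)
  q = suc (suc j)
  F = ∑[ k < suc n ] f (suc k)
  G = ∑[ k < suc n ] g (suc k)
  agree′ : ∀ k → k ≢ inject₁ j → k ≢ suc j → f (suc k) ≡ g (suc k)
  agree′ k k≢p k≢q = agree (suc k) (k≢p ∘ Fin.suc-injective) (k≢q ∘ Fin.suc-injective)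

-- Weighted sums

weightedSum : ∀ {N} → (Fin N → ℕ) → Permutation′ N → ℕ
weightedSum {N} w π = ∑[ k < N ] (w k * val π k)

weightedSum-+ : ∀ {N} (w₁ w₂ : Fin N → ℕ) (π : Permutation′ N) →
                weightedSum w₁ π + weightedSum w₂ π ≡ weightedSum (λ k → w₁ k + w₂ k) π
weightedSum-+ {N} w₁ w₂ π =
  trans (sym (∑-distrib-+ (λ k → w₁ k * val π k) (λ k → w₂ k * val π k))) (sum-cong-≗ {N} (λ k → sym (*-distribʳ-+ (val π k) (w₁ k) (w₂ k))))

sum-val : ∀ {N} (π : Permutation′ N) → ∑[ k < N ] val π k ≡ suc N C 2
sum-val {N} π = trans (sym (sum-permute (λ k → suc (toℕ k)) π)) (sum-suc-toℕ N)

weightedSum<sum-val : ∀ {N} (w : Fin N → ℕ) (π : Permutation′ N) z →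
                      (∀ k → w k ≤ 1) → w z ≡ 0 → weightedSum w π < suc N C 2
weightedSum<sum-val w π z w≤1 wz≡0 = <-≤-trans (sum-mono-< bounded z strict) (≤-reflexive (sum-val π))
  where
  bounded : ∀ k → w k * val π k ≤ val π k
  bounded k = ≤-trans (*-monoˡ-≤ (val π k) (w≤1 k)) (≤-reflexive (*-identityˡ (val π k)))
  strict : w z * val π z < val π z
  strict rewrite wz≡0 = z<s

interval : ∀ {N} → Fin N → Fin N → Fin N → ℕ
interval u v k = indicator (toℕ k ≤? toℕ v) * indicator (toℕ u ≤? toℕ k)

segSum≡weightedSum : ∀ {N} (π : Permutation′ N) u v → segSum π u v ≡ weightedSum (interval u v) π
segSum≡weightedSum {N} π u v = begin
  segSum π u v
    ≡⟨ sum-map-filter (λ k → toℕ u ≤? toℕ k) (val π) (filter (λ k → toℕ k ≤? toℕ v) (allFin N)) ⟩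
  sum (map (λ k → from-u k * val π k) (filter (λ k → toℕ k ≤? toℕ v) (allFin N)))
    ≡⟨ sum-map-filter (λ k → toℕ k ≤? toℕ v) (λ k → from-u k * val π k) (allFin N) ⟩
  sum (map (λ k → up-to-v k * (from-u k * val π k)) (allFin N))
    ≡⟨ sum-map-tabulate (λ k → up-to-v k * (from-u k * val π k)) id ⟩
  ∑[ k < N ] (up-to-v k * (from-u k * val π k))
    ≡⟨ sum-cong-≗ {N} (λ k → sym (*-assoc (up-to-v k) (from-u k) (val π k))) ⟩
  weightedSum (interval u v) π
    ∎
  where
  open ≡-Reasoning
  from-u up-to-v : Fin N → ℕ
  from-u k = indicator (toℕ u ≤? toℕ k)
  up-to-v k = indicator (toℕ k ≤? toℕ v)

interval≤1 : ∀ {N} (u v k : Fin N) → interval u v k ≤ 1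
interval≤1 u v k = *-mono-≤ (indicator≤1 (toℕ k ≤? toℕ v)) (indicator≤1 (toℕ u ≤? toℕ k))

interval-before : ∀ {N} {u v k : Fin N} → toℕ k < toℕ u → interval u v k ≡ 0
interval-before {u = u} {v} {k} k<u =
  trans (cong (indicator (toℕ k ≤? toℕ v) *_) (indicator-no (toℕ u ≤? toℕ k) (<⇒≱ k<u))) (*-zeroʳ (indicator (toℕ k ≤? toℕ v)))

interval-after : ∀ {N} {u v k : Fin N} → toℕ v < toℕ k → interval u v k ≡ 0
interval-after {v = v} {k} v<k = cong (_* _) (indicator-no (toℕ k ≤? toℕ v) (<⇒≱ v<k))

-- Long segments and the cut

separated-segSums : ∀ {N} (a : Permutation′ N) {u₀ v₀ u v : Fin N} → suc (toℕ v₀) < toℕ u →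
                    segSum a u₀ v₀ + segSum a u v < suc N C 2
separated-segSums {N} a {u₀} {v₀} {u} {v} gap = begin-strict
  segSum a u₀ v₀ + segSum a u v
    ≡⟨ cong₂ _+_ (segSum≡weightedSum a u₀ v₀) (segSum≡weightedSum a u v) ⟩
  weightedSum (interval u₀ v₀) a + weightedSum (interval u v) a
    ≡⟨ weightedSum-+ (interval u₀ v₀) (interval u v) a ⟩
  weightedSum (λ k → interval u₀ v₀ k + interval u v k) a
    <⟨ weightedSum<sum-val _ a z disjoint (cong₂ _+_ (interval-after v₀<z) (interval-before z<u)) ⟩
  suc N C 2
    ∎
  where
  open ≤-Reasoning
  z : Fin N
  z = fromℕ< (<-trans gap (Fin.toℕ<n u))
  v₀<z : toℕ v₀ < toℕ z
  v₀<z = ≤-reflexive (sym (Fin.toℕ-fromℕ< _))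
  z<u : toℕ z < toℕ u
  z<u = subst (_< toℕ u) (sym (Fin.toℕ-fromℕ< _)) gap
  disjoint : ∀ k → interval u₀ v₀ k + interval u v k ≤ 1
  disjoint k with toℕ v₀ <? toℕ k
  ... | yes v₀<k = ≤-trans (≤-reflexive (cong (_+ interval u v k) (interval-after v₀<k))) (interval≤1 u v k)
  ... | no  v₀≮k = ≤-trans (≤-reflexive (trans (cong (interval u₀ v₀ k +_) (interval-before (<-trans (s≤s (≮⇒≥ v₀≮k)) gap)))
                                                  (+-identityʳ _)))
                           (interval≤1 u₀ v₀ k)

Long : ∀ {N} → Permutation′ N → Fin N → Fin N → Set
Long {N} a u v = suc N C 2 ≤ 2 * segSum a u v

long-segments-meet : ∀ {N} (a : Permutation′ N) (u₀ v₀ u v : Fin N) →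
                      Long a u₀ v₀ → Long a u v → toℕ u ≤ suc (toℕ v₀)
long-segments-meet {N} a u₀ v₀ u v long₀ long with toℕ u ≤? suc (toℕ v₀)
... | yes u≤v₀+1 = u≤v₀+1
... | no  u≰v₀+1 = contradiction (+-mono-≤ long₀ long) (<⇒≱ (begin-strict
  2 * s₀ + 2 * s  ≡⟨ *-distribˡ-+ 2 s₀ s ⟨
  2 * (s₀ + s)    <⟨ *-monoʳ-< 2 (separated-segSums a (≰⇒> u≰v₀+1)) ⟩
  2 * T           ≡⟨ cong (T +_) (+-identityʳ T) ⟩
  T + T           ∎))
  where
  open ≤-Reasoning
  T = suc N C 2
  s₀ = segSum a u₀ v₀
  s = segSum a u v

∈Lset⇒long : ∀ {N} {a : Permutation′ N} {x} → x ∈ Lset a → Long a (proj₁ x) (proj₂ x)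
∈Lset⇒long {N} {a} x∈L = proj₂ (∈-filter⁻ (λ x → suc N C 2 ≤? 2 * segSum a (proj₁ x) (proj₂ x)) {xs = pairs N} x∈L)

cardL-mono : ∀ {N} (a b : Permutation′ N) → (∀ {x} → x ∈ Lset a → Long b (proj₁ x) (proj₂ x)) →
             cardL a ≤ cardL b
cardL-mono {N} a b long = length-filter-mono _ _ (pairs N) (All.tabulate long)

-- The cut in front of position m meets the segment of positions u … v.
Crosses : ∀ {N} → ℕ → Fin N × Fin N → Set
Crosses m (u , v) = toℕ u ≤ m × m ≤ suc (toℕ v)

-- The cut is placed right after the leftmost right end of a long segment.
commonCut : ∀ {n} (a : Permutation′ (suc n)) →
            Σ[ c ∈ Fin (suc n) ] (∀ {x} → x ∈ Lset a → Crosses (suc (toℕ c)) x)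
commonCut {n} a = proj₂ shortest , λ x∈L → meets x∈L , s≤s (All.lookup ends-first x∈L)
  where
  N = suc n
  rightEnd : Fin N × Fin N → ℕ
  rightEnd = toℕ ∘ proj₂
  top : Fin N × Fin N
  top = fromℕ n , fromℕ n
  shortest : Fin N × Fin N
  shortest = argmin rightEnd top (Lset a)
  ends-first : All (λ x → rightEnd shortest ≤ rightEnd x) (Lset a)
  ends-first = f[argmin]≤f[xs] top (Lset a)
  MeetsAll : Fin N × Fin N → Set
  MeetsAll y = ∀ {x} → x ∈ Lset a → toℕ (proj₁ x) ≤ suc (rightEnd y)
  top-meets : MeetsAll top
  top-meets {u , _} _ = ≤-trans (≤-pred (Fin.toℕ<n u)) (≤-trans (≤-reflexive (sym (Fin.toℕ-fromℕ n))) (n≤1+n _))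
  meets : MeetsAll shortest
  meets = argmin-all rightEnd {xs = Lset a} {P = MeetsAll} top-meets
            (All.tabulate λ {(u₀ , v₀)} y∈L {(u , v)} x∈L → long-segments-meet a u₀ v₀ u v (∈Lset⇒long {a = a} y∈L) (∈Lset⇒long {a = a} x∈L))

-- The adjacent pair straddling the cut, at positions m − 1 and m, is left unconstrained.
module _ {n : ℕ} where

  OrderedAroundCut : (ℕ → ℕ → Set) → ℕ → (Fin (suc n) → ℕ) → Fin n → Set
  OrderedAroundCut _R_ m f j = (suc (toℕ j) < m → f (inject₁ j) R f (suc j))
                             × (m ≤ toℕ j → f (suc j) R f (inject₁ j))

  SortedAroundCut : (ℕ → ℕ → Set) → ℕ → (Fin (suc n) → ℕ) → Set
  SortedAroundCut R m f = ∀ j → OrderedAroundCut R m f j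

interval-mono : ∀ {N} {u v k k′ : Fin N} → (toℕ k ≤ toℕ v → toℕ k′ ≤ toℕ v) → (toℕ u ≤ toℕ k → toℕ u ≤ toℕ k′) →
                interval u v k ≤ interval u v k′
interval-mono {u = u} {v} {k} {k′} ≤v u≤ =
  *-mono-≤ (indicator-mono (toℕ k ≤? toℕ v) (toℕ k′ ≤? toℕ v) ≤v) (indicator-mono (toℕ u ≤? toℕ k) (toℕ u ≤? toℕ k′) u≤)

interval-sorted : ∀ {n m} {u v : Fin (suc n)} → Crosses m (u , v) → SortedAroundCut _≤_ m (interval u v)
interval-sorted {m = m} {u} {v} (u≤m , m≤v+1) j = rising , falling
  where
  j≤j+1 : toℕ (inject₁ j) ≤ suc (toℕ j)
  j≤j+1 = ≤-trans (≤-reflexive (Fin.toℕ-inject₁ j)) (n≤1+n _)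
  rising : suc (toℕ j) < m → interval u v (inject₁ j) ≤ interval u v (suc j)
  rising j+1<m = interval-mono (λ _ → ≤-pred (<-≤-trans j+1<m m≤v+1)) (λ u≤j → ≤-trans u≤j j≤j+1)
  falling : m ≤ toℕ j → interval u v (suc j) ≤ interval u v (inject₁ j)
  falling m≤j = interval-mono (≤-trans j≤j+1) (λ _ → ≤-trans (≤-trans u≤m m≤j) (≤-reflexive (sym (Fin.toℕ-inject₁ j))))

-- Bubble sort towards the cut

∣1+x-m∣<∣x-m∣ : ∀ {x m} → suc x < m → ∣ suc x - m ∣ < ∣ x - m ∣
∣1+x-m∣<∣x-m∣ {zero}  {suc zero}    (s≤s ())
∣1+x-m∣<∣x-m∣ {zero}  {suc (suc m)} _           = n<1+n (suc m)
∣1+x-m∣<∣x-m∣ {suc x} {suc m}       (s≤s x+1<m) = ∣1+x-m∣<∣x-m∣ x+1<m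

∣x-m∣<∣1+x-m∣ : ∀ {x m} → m ≤ x → ∣ x - m ∣ < ∣ suc x - m ∣
∣x-m∣<∣1+x-m∣ {zero}  {zero}  _         = z<s
∣x-m∣<∣1+x-m∣ {suc x} {zero}  _         = n<1+n (suc x)
∣x-m∣<∣1+x-m∣ {suc x} {suc m} (s≤s m≤x) = ∣x-m∣<∣1+x-m∣ m≤x

cutDistance : ∀ {N} → ℕ → Fin N → ℕ
cutDistance m k = ∣ toℕ k - m ∣

cutDistance-sorted : ∀ {n} m → SortedAroundCut _>_ m (cutDistance {suc n} m)
cutDistance-sorted m j =
  (λ j+1<m → subst (λ t → ∣ suc (toℕ j) - m ∣ < ∣ t - m ∣) (sym (Fin.toℕ-inject₁ j)) (∣1+x-m∣<∣x-m∣ j+1<m)) ,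
  (λ m≤j → subst (λ t → ∣ t - m ∣ < ∣ suc (toℕ j) - m ∣) (sym (Fin.toℕ-inject₁ j)) (∣x-m∣<∣1+x-m∣ m≤j))

rearrangement-≤ : ∀ {a b c d} → a ≤ b → c ≤ d → a * d + b * c ≤ a * c + b * d
rearrangement-≤ {a} {c = c} a≤b c≤d
  with x , refl ← m≤n⇒∃[o]m+o≡n a≤b | y , refl ← m≤n⇒∃[o]m+o≡n c≤d
  = ≤-trans (m≤m+n _ (x * y)) (≤-reflexive (exchange a x c y))
  where
  exchange : ∀ a x c y → a * (c + y) + (a + x) * c + x * y ≡ a * c + (a + x) * (c + y)
  exchange = solve-∀

rearrangement-< : ∀ {a b c d} → a < b → c < d → a * d + b * c < a * c + b * d
rearrangement-< {a} {c = c} a<b c<d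
  with x , refl ← m≤n⇒∃[o]m+o≡n a<b | y , refl ← m≤n⇒∃[o]m+o≡n c<d
  = <-≤-trans (m<m+n _ z<s) (≤-reflexive (exchange a x c y))
  where
  exchange : ∀ a x c y → a * suc (c + y) + suc (a + x) * c + suc x * suc y ≡ a * c + suc (a + x) * suc (c + y)
  exchange = solve-∀

val-injective : ∀ {N} (π : Permutation′ N) {i j} → val π i ≡ val π j → i ≡ j
val-injective π {i} {j} eq = begin
  i                    ≡⟨ inverseˡ π ⟨
  π ⟨$⟩ˡ (π ⟨$⟩ʳ i)    ≡⟨ cong (π ⟨$⟩ˡ_) (Fin.toℕ-injective (suc-injective eq)) ⟩
  π ⟨$⟩ˡ (π ⟨$⟩ʳ j)    ≡⟨ inverseˡ π ⟩
  j                    ∎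
  where open ≡-Reasoning

inject₁≢suc : ∀ {n} (j : Fin n) → inject₁ j ≢ suc j
inject₁≢suc j eq = 1+n≢n (sym (trans (sym (Fin.toℕ-inject₁ j)) (cong toℕ eq)))

swap : ∀ {n} → Permutation′ (suc n) → Fin n → Permutation′ (suc n)
swap π j = transpose (inject₁ j) (suc j) ∘ₚ π

module _ {n} (π : Permutation′ (suc n)) (j : Fin n) where

  val-swap-left : val (swap π j) (inject₁ j) ≡ val π (suc j)
  val-swap-left rewrite dec-true (inject₁ j Fin.≟ inject₁ j) refl = refl

  val-swap-right : val (swap π j) (suc j) ≡ val π (inject₁ j)
  val-swap-right rewrite dec-false (suc j Fin.≟ inject₁ j) (inject₁≢suc j ∘ sym)
                       | dec-true (suc j Fin.≟ suc j) refl = refl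

  val-swap-other : ∀ k → k ≢ inject₁ j → k ≢ suc j → val (swap π j) k ≡ val π k
  val-swap-other k k≢p k≢q rewrite dec-false (k Fin.≟ inject₁ j) k≢p | dec-false (k Fin.≟ suc j) k≢q = refl

  pairTerms swappedPairTerms : (Fin (suc n) → ℕ) → ℕ
  pairTerms        w = w (inject₁ j) * val π (inject₁ j) + w (suc j) * val π (suc j)
  swappedPairTerms w = w (inject₁ j) * val π (suc j) + w (suc j) * val π (inject₁ j)

  weightedSum-swap : ∀ w → weightedSum w (swap π j) + pairTerms w ≡ weightedSum w π + swappedPairTerms w
  weightedSum-swap w =
    trans (sum-agreeExcept-adjacent j _ _ (λ k k≢p k≢q → cong (w k *_) (val-swap-other k k≢p k≢q)))
          (cong (weightedSum w π +_) (cong₂ _+_ (cong (w (inject₁ j) *_) val-swap-left)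
                                                (cong (w (suc j) *_) val-swap-right)))

  weightedSum-swap-≤ : ∀ w → pairTerms w ≤ swappedPairTerms w → weightedSum w π ≤ weightedSum w (swap π j)
  weightedSum-swap-≤ w gain = +-cancelʳ-≤ (swappedPairTerms w) _ _ (begin
    weightedSum w π + swappedPairTerms w   ≡⟨ weightedSum-swap w ⟨
    weightedSum w (swap π j) + pairTerms w ≤⟨ +-monoʳ-≤ (weightedSum w (swap π j)) gain ⟩
    weightedSum w (swap π j) + swappedPairTerms w ∎)
    where open ≤-Reasoning

  weightedSum-swap-< : ∀ w → swappedPairTerms w < pairTerms w → weightedSum w (swap π j) < weightedSum w π
  weightedSum-swap-< w loss = +-cancelʳ-< (pairTerms w) _ _ (begin-strict
    weightedSum w (swap π j) + pairTerms w ≡⟨ weightedSum-swap w ⟩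
    weightedSum w π + swappedPairTerms w   <⟨ +-monoʳ-< (weightedSum w π) loss ⟩
    weightedSum w π + pairTerms w          ∎)
    where open ≤-Reasoning

Dominates : ∀ {n} → ℕ → Permutation′ (suc n) → Permutation′ (suc n) → Set
Dominates m π π′ = ∀ w → SortedAroundCut _≤_ m w → weightedSum w π ≤ weightedSum w π′

potential : ∀ {N} → ℕ → Permutation′ N → ℕ
potential m π = weightedSum (cutDistance m) π

Improving : ∀ {n} → ℕ → Permutation′ (suc n) → Fin n → Set
Improving m π j = potential m (swap π j) < potential m π × Dominates m π (swap π j)

module _ {n} (m : ℕ) (π : Permutation′ (suc n)) (j : Fin n) where

  private
    d : Fin (suc n) → ℕ
    d = cutDistance m
    vp vq : ℕ
    vp = val π (inject₁ j)
    vq = val π (suc j)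

  improving-left : suc (toℕ j) < m → vq < vp → Improving m π j
  improving-left left fall =
    weightedSum-swap-< π j d
      (subst₂ _<_ (+-comm (d (suc j) * vp) (d (inject₁ j) * vq)) (+-comm (d (suc j) * vq) (d (inject₁ j) * vp))
              (rearrangement-< (proj₁ (cutDistance-sorted m j) left) fall)) ,
    λ w sorted → weightedSum-swap-≤ π j w (rearrangement-≤ (proj₁ (sorted j) left) (<⇒≤ fall))

  improving-right : m ≤ toℕ j → vp < vq → Improving m π j
  improving-right right rise =
    weightedSum-swap-< π j d (rearrangement-< (proj₂ (cutDistance-sorted m j) right) rise) ,
    λ w sorted → weightedSum-swap-≤ π j w
                   (subst₂ _≤_ (+-comm (w (suc j) * vq) (w (inject₁ j) * vp)) (+-comm (w (suc j) * vp) (w (inject₁ j) * vq))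
                           (rearrangement-≤ (proj₂ (sorted j) right) (<⇒≤ rise)))

  orderedAroundCut-or-improving : OrderedAroundCut _<_ m (val π) j ⊎ Improving m π j
  orderedAroundCut-or-improving with <-cmp (suc (toℕ j)) m | <-cmp (val π (inject₁ j)) (val π (suc j))
  ... | _               | tri≈ _ same _ = contradiction (val-injective π same) (inject₁≢suc j)
  ... | tri< left _ _   | tri< rise _ _ = inj₁ ((λ _ → rise) , λ m≤j → contradiction (≤-trans m≤j (n≤1+n _)) (<⇒≱ left))
  ... | tri< left _ _   | tri> _ _ fall = inj₂ (improving-left left fall)
  ... | tri≈ _ at _     | _             = inj₁ ((λ left → contradiction at (<⇒≢ left)) ,
                                               λ m≤j → contradiction (subst (_≤ toℕ j) (sym at) m≤j) 1+n≰n)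
  ... | tri> _ _ right  | tri< rise _ _ = inj₂ (improving-right (≤-pred right) rise)
  ... | tri> _ _ right  | tri> _ _ fall = inj₁ ((λ left → contradiction left (<-asym right)) , λ _ → fall)

∀⊎∃ : ∀ {n} {P Q : Fin n → Set} → (∀ i → P i ⊎ Q i) → (∀ i → P i) ⊎ ∃ Q
∀⊎∃ {zero}          _   = inj₁ λ ()
∀⊎∃ {suc n} {P} {Q} p⊎q with p⊎q zero | ∀⊎∃ {P = P ∘ suc} {Q = Q ∘ suc} (p⊎q ∘ suc)
... | inj₂ q₀ | _             = inj₂ (zero , q₀)
... | inj₁ _  | inj₂ (i , qᵢ) = inj₂ (suc i , qᵢ)
... | inj₁ p₀ | inj₁ ps       = inj₁ λ { zero → p₀ ; (suc i) → ps i }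

sortAroundCut : ∀ {n} m (a : Permutation′ (suc n)) →
                Σ[ a′ ∈ Permutation′ (suc n) ] SortedAroundCut _<_ m (val a′) × Dominates m a a′
sortAroundCut {n} m a = go a (<-wellFounded (potential m a))
  where
  go : ∀ π → Acc _<_ (potential m π) →
       Σ[ π′ ∈ Permutation′ (suc n) ] SortedAroundCut _<_ m (val π′) × Dominates m π π′
  go π (acc smaller) with ∀⊎∃ (orderedAroundCut-or-improving m π)
  ... | inj₁ sorted = π , sorted , λ _ _ → ≤-refl
  ... | inj₂ (j , lowers , raises) with go (swap π j) (smaller lowers)
  ...   | π′ , sorted , raises′ = π′ , sorted , λ w w-sorted → ≤-trans (raises w w-sorted) (raises′ w w-sorted)

-- Unimodality

module _ {n} (π : Permutation′ (suc n)) where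

  increasingUpTo : ∀ {k} → (∀ j → suc (toℕ j) ≤ toℕ k → val π (inject₁ j) < val π (suc j)) → IncreasingUpTo π k
  increasingUpTo {k} rise i = <-weakInduction P (λ ()) step
    where
    P : Fin (suc n) → Set
    P j = toℕ i < toℕ j → toℕ j ≤ toℕ k → val π i < val π j
    step : ∀ j → P (inject₁ j) → P (suc j)
    step j ih i<j+1 j+1≤k with Fin.<-cmp i (inject₁ j)
    ... | tri< i<j _ _ = <-trans (ih i<j (<⇒≤ (<-≤-trans (Fin.≤̄⇒inject₁< ≤-refl) j+1≤k))) (rise j j+1≤k)
    ... | tri≈ _ refl _ = rise j j+1≤k
    ... | tri> _ _ j<i = contradiction (subst (toℕ i ≤_) (sym (Fin.toℕ-inject₁ j)) (≤-pred i<j+1)) (<⇒≱ j<i)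

  decreasingFrom : ∀ {k} → (∀ j → toℕ k ≤ toℕ j → val π (suc j) < val π (inject₁ j)) → DecreasingFrom π k
  decreasingFrom {k} fall i = <-weakInduction P (λ _ ()) step
    where
    P : Fin (suc n) → Set
    P j = toℕ k ≤ toℕ i → toℕ i < toℕ j → val π j < val π i
    step : ∀ j → P (inject₁ j) → P (suc j)
    step j ih k≤i i<j+1 with Fin.<-cmp i (inject₁ j)
    ... | tri< i<j _ _ = <-trans (fall j (≤-trans k≤i (≤-trans (<⇒≤ i<j) (≤-reflexive (Fin.toℕ-inject₁ j))))) (ih k≤i i<j)
    ... | tri≈ _ refl _ = fall j (subst (toℕ k ≤_) (Fin.toℕ-inject₁ j) k≤i)
    ... | tri> _ _ j<i = contradiction (subst (toℕ i ≤_) (sym (Fin.toℕ-inject₁ j)) (≤-pred i<j+1)) (<⇒≱ j<i)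

  Unimodal : Set
  Unimodal = Σ[ k ∈ Fin (suc n) ] IncreasingUpTo π k × DecreasingFrom π k

  unimodal-around : (j₀ : Fin n) → SortedAroundCut _<_ (suc (toℕ j₀)) (val π) → Unimodal
  unimodal-around j₀ sorted with <-cmp (val π (inject₁ j₀)) (val π (suc j₀))
  ... | tri< rise _ _ = suc j₀ , increasingUpTo rising , decreasingFrom (λ j → proj₂ (sorted j))
    where
    rising : ∀ j → suc (toℕ j) ≤ suc (toℕ j₀) → val π (inject₁ j) < val π (suc j)
    rising j (s≤s j≤j₀) with m≤n⇒m<n∨m≡n j≤j₀
    ... | inj₁ j<j₀ = proj₁ (sorted j) (s≤s j<j₀)
    ... | inj₂ j≡j₀ rewrite Fin.toℕ-injective j≡j₀ = rise
  ... | tri≈ _ same _ = contradiction (val-injective π same) (inject₁≢suc j₀)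
  ... | tri> _ _ fall = inject₁ j₀ , increasingUpTo rising , decreasingFrom falling
    where
    rising : ∀ j → suc (toℕ j) ≤ toℕ (inject₁ j₀) → val π (inject₁ j) < val π (suc j)
    rising j j<j₀ = proj₁ (sorted j) (s≤s (subst (suc (toℕ j) ≤_) (Fin.toℕ-inject₁ j₀) j<j₀))
    falling : ∀ j → toℕ (inject₁ j₀) ≤ toℕ j → val π (suc j) < val π (inject₁ j)
    falling j j₀≤j with m≤n⇒m<n∨m≡n (subst (_≤ toℕ j) (Fin.toℕ-inject₁ j₀) j₀≤j)
    ... | inj₁ j₀<j = proj₂ (sorted j) j₀<j
    ... | inj₂ j₀≡j rewrite Fin.toℕ-injective j₀≡j = fall

  unimodal : (c : Fin (suc n)) → SortedAroundCut _<_ (suc (toℕ c)) (val π) → Unimodal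
  unimodal c sorted with n ≟ toℕ c
  ... | yes c-last = c , increasingUpTo (λ j j<c → proj₁ (sorted j) (s≤s j<c))
                       , decreasingFrom (λ j c≤j → contradiction (subst (_≤ toℕ j) (sym c-last) c≤j) (<⇒≱ (Fin.toℕ<n j)))
  ... | no c-inner = unimodal-around (lower₁ c c-inner)
                       (subst (λ t → SortedAroundCut _<_ (suc t) (val π)) (sym (Fin.toℕ-lower₁ c c-inner)) sorted)

segSum-dominated : ∀ {n m} {a a′ : Permutation′ (suc n)} → Dominates m a a′ →
                   ∀ {u v} → Crosses m (u , v) → segSum a u v ≤ segSum a′ u v
segSum-dominated {a = a} {a′} dominates {u} {v} crosses =
  subst₂ _≤_ (sym (segSum≡weightedSum a u v)) (sym (segSum≡weightedSum a′ u v))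
         (dominates (interval u v) (interval-sorted crosses))

mainTheorem13 : (n : ℕ) → (a : Permutation′ (suc n)) →
    Σ (Permutation′ (suc n)) (λ a′ → Σ (Fin (suc n)) (λ k →
      (cardL a ≤ cardL a′) × IncreasingUpTo a′ k × DecreasingFrom a′ k))
mainTheorem13 n a with commonCut a
... | c , crosses with sortAroundCut (suc (toℕ c)) a
... | a′ , sorted , dominates with unimodal a′ c sorted
... | k , increasing , decreasing = a′ , k , cardL-mono a a′ stays-long , increasing , decreasing
  where
  stays-long : ∀ {x} → x ∈ Lset a → Long a′ (proj₁ x) (proj₂ x)
  stays-long x∈L = ≤-trans (∈Lset⇒long {a = a} x∈L) (*-monoʳ-≤ 2 (segSum-dominated {a = a} {a′} dominates (crosses x∈L)))
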